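{- A principal MS-algebra $L$ is a perfect extension of its greatest Stone subalgebra $L_S$ if and only if the de Morgan algebra $L^{\circ\circ}$ is a perfect extension of its subalgebra $B(L)$.
   Context: An MS-algebra is an algebra $(L;\vee,\wedge,{}^{\circ},0,1)$ where $(L;\vee,\wedge,0,1)$ is a bounded distributive lattice and ${}^{\circ}$ is a unary operation with $x\le x^{\circ\circ}$, $(x\wedge y)^{\circ}=x^{\circ}\vee y^{\circ}$ and $1^{\circ}=0$. For an MS-algebra $L$: $L^{\circ\circ}=\{x\mid x=x^{\circ\circ}\}$ is a de Morgan subalgebra; $D(L)=\{x\mid x^{\circ}=0\}$; $B(L)=\{x\mid x\vee x^{\circ}=1\}$ is a Boolean subalgebra (contained in $L^{\circ\circ}$); $L_S=\{x\mid x^{\circ}\vee x^{\circ\circ}=1\}$ is the greatest Stone subalgebra of $L$. $L$ is a principal MS-algebra if there is $d_L$ with $D(L)=\{x\mid x\ge d_L\}$ and $x=x^{\circ\circ}\wedge(x\vee d_L)$ for all $x$. An algebra $A$ is a perfect extension of a subalgebra $B$ if every congruence of $B$ has exactly one extension to a congruence of $A$. -}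

module Defs where

open import Data.Product using (_×_; Σ; _,_)
open import Data.Unit using (⊤)
open import Relation.Binary.PropositionalEquality using (_≡_)
open import Algebra.Core using (Op₁; Op₂)
open import Algebra.Lattice.Structures using (IsDistributiveLattice)
open import Function.Bundles using (_⇔_)

record MSAlgebra : Set₁ where
  infixr 6 _∨_
  infixr 7 _∧_
  field
    Carrier : Set
    _∨_ _∧_ : Op₂ Carrier
    _° : Op₁ Carrier
    𝟎 𝟏 : Carrier
    isDistributiveLattice : IsDistributiveLattice _≡_ _∨_ _∧_
    ∨-identityˡ : ∀ x → 𝟎 ∨ x ≡ x
    ∧-identityˡ : ∀ x → 𝟏 ∧ x ≡ x
    ≤°° : ∀ x → x ∧ ((x °) °) ≡ x
    ∧-° : ∀ x y → (x ∧ y) ° ≡ (x °) ∨ (y °)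
    𝟏° : 𝟏 ° ≡ 𝟎

  _≤_ : Carrier → Carrier → Set
  x ≤ y = x ∧ y ≡ x

  L°° : Carrier → Set
  L°° x = x ≡ (x °) °

  D : Carrier → Set
  D x = x ° ≡ 𝟎

  B : Carrier → Set
  B x = x ∨ (x °) ≡ 𝟏

  L-S : Carrier → Set
  L-S x = (x °) ∨ ((x °) °) ≡ 𝟏

  whole : Carrier → Set
  whole _ = ⊤

  -- Congruences of the subalgebra (in the MS signature ∨, ∧, °, 0, 1)
  -- carried by a subset P of L, represented as relations on L supported on P.
  record Congruence (P : Carrier → Set) : Set₁ where
    field
      rel : Carrier → Carrier → Set
      support : ∀ {x y} → rel x y → P x × P y
      refl : ∀ {x} → P x → rel x x
      sym : ∀ {x y} → rel x y → rel y x
      trans : ∀ {x y z} → rel x y → rel y z → rel x z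
      ∨-cong : ∀ {x y u v} → rel x y → rel u v → rel (x ∨ u) (y ∨ v)
      ∧-cong : ∀ {x y u v} → rel x y → rel u v → rel (x ∧ u) (y ∧ v)
      °-cong : ∀ {x y} → rel x y → rel (x °) (y °)

  open Congruence public

  Extends : {A Q : Carrier → Set} → Congruence A → Congruence Q → Set
  Extends {Q = Q} θ φ = ∀ x y → Q x → Q y → (rel θ x y ⇔ rel φ x y)

  PerfectExtension : (A Q : Carrier → Set) → Set₁
  PerfectExtension A Q =
    ∀ (φ : Congruence Q) →
      Σ (Congruence A) (λ θ → Extends θ φ)
      × (∀ (θ₁ θ₂ : Congruence A) → Extends θ₁ φ → Extends θ₂ φ →
           ∀ x y → (rel θ₁ x y ⇔ rel θ₂ x y))

  IsPrincipalWith : Carrier → Set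
  IsPrincipalWith d =
    (∀ x → (D x ⇔ d ≤ x)) × (∀ x → x ≡ ((x °) °) ∧ (x ∨ d))

  IsPrincipal : Set
  IsPrincipal = Σ Carrier IsPrincipalWith

-- Both directions transport congruences along two operations:
--   * pulling back along the homomorphism x ↦ x°° of L onto L°°, which maps
--     L-S onto B (x ∈ L-S iff x°° ∈ B), and
--   * restricting to the subalgebra L°°, which cuts L-S down to B = L-S ∩ L°°;
-- both operations preserve the relation "θ extends φ" (lift-extends,
-- lower-extends).
-- (⇒) needs no principality: a congruence φ of B is extended by pulling it back
-- to L-S, extending to L and restricting to L°°; two extensions to L°° agree
-- because their pullbacks to L both extend the pullback of φ.
-- (⇐) uses that a principal L with dense generator d separates points by
-- x ↦ (x°°, x ∨ d), where x ∨ d ∈ L-S.  A congruence φ of L-S restricts to B,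
-- extends to θ₁ on L°°, and glues with φ on the elements x ∨ d to a congruence
-- of L (glue); that the glued relation respects ° comes from θ₁ being the
-- least congruence of L°° containing φ on B (extension-least), hence lying
-- below the congruence trace φ.
module Submission where

open import Data.Product using (_×_; _,_; proj₁; proj₂)
open import Data.Product.Function.NonDependent.Propositional using (_×-⇔_)
open import Data.Unit using (tt)
open import Function.Bundles using (_⇔_; mk⇔; Equivalence)
open import Function.Related.Propositional using (Kind)
import Function.Related.Propositional as Related
import Function.Properties.Equivalence as ⇔
open import Algebra.Lattice.Bundles using (Lattice)
open import Algebra.Lattice.Structures using (IsDistributiveLattice)
import Algebra.Lattice.Properties.Lattice as LatticeProperties
import Relation.Binary.Lattice as OrderTheoretic
import Relation.Binary.PropositionalEquality as ≡
open ≡ using (_≡_; cong; cong₂; subst; subst₂)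

open import Defs

open Equivalence using (to; from)
module ⇔-Reasoning = Related.EquationalReasoning {k = Kind.equivalence}

module Theory (L : MSAlgebra) where
  open MSAlgebra L
  open IsDistributiveLattice isDistributiveLattice
    using (∨-comm; ∨-assoc; ∧-comm; ∧-absorbs-∨; ∧-distribˡ-∨; ∨-distribʳ-∧; isLattice)

  lattice : Lattice _ _
  lattice = record { isLattice = isLattice }

  -- The order-theoretic lattice of L, with x ⊑ y meaning x ≡ x ∧ y
  -- (the mirror image of the relation _≤_ of Defs).
  open LatticeProperties lattice using (∧-idem; ∨-idem; ∨-∧-orderTheoreticLattice)
  open OrderTheoretic.Lattice ∨-∧-orderTheoreticLattice
    using (x≤x∨y; y≤x∨y; ∨-least; ∧-greatest; antisym)
    renaming (_≤_ to _⊑_; trans to ⊑-trans)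

  _°° : Carrier → Carrier
  x °° = (x °) °

  x⊑x°° : ∀ x → x ⊑ x °°
  x⊑x°° x = ≡.sym (≤°° x)

  °-antitone : ∀ {x y} → x ⊑ y → y ° ⊑ x °
  °-antitone {x} {y} x⊑y = subst (y ° ⊑_) join≡ (y≤x∨y (x °) (y °))
    where
    join≡ : x ° ∨ y ° ≡ x °
    join≡ = ≡.trans (≡.sym (∧-° x y)) (cong _° (≡.sym x⊑y))

  °°°≡° : ∀ x → (x °°) ° ≡ x °
  °°°≡° x = antisym (°-antitone (x⊑x°° x)) (x⊑x°° (x °))

  ∨-° : ∀ x y → (x ∨ y) ° ≡ x ° ∧ y °
  ∨-° x y = antisym (∧-greatest (°-antitone (x≤x∨y x y)) (°-antitone (y≤x∨y x y))) ∧⊑∨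
    where
    ∨⊑∨°° : x ∨ y ⊑ x °° ∨ y °°
    ∨⊑∨°° = ∨-least (⊑-trans (x⊑x°° x) (x≤x∨y _ _)) (⊑-trans (x⊑x°° y) (y≤x∨y _ _))
    -- (x° ∧ y°)°° is (x°° ∨ y°°)°
    ∧⊑∨ : x ° ∧ y ° ⊑ (x ∨ y) °
    ∧⊑∨ = ⊑-trans (x⊑x°° _)
      (subst (_⊑ (x ∨ y) °) (cong _° (≡.sym (∧-° (x °) (y °)))) (°-antitone ∨⊑∨°°))

  °°-∨ : ∀ x y → (x ∨ y) °° ≡ x °° ∨ y °°
  °°-∨ x y = ≡.trans (cong _° (∨-° x y)) (∧-° (x °) (y °))

  °°-∧ : ∀ x y → (x ∧ y) °° ≡ x °° ∧ y °°
  °°-∧ x y = ≡.trans (cong _° (∧-° x y)) (∨-° (x °) (y °))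

  𝟎⊑ : ∀ x → 𝟎 ⊑ x
  𝟎⊑ x = ≡.trans (≡.sym (∧-absorbs-∨ 𝟎 x)) (cong (𝟎 ∧_) (∨-identityˡ x))

  ⊑𝟏 : ∀ x → x ⊑ 𝟏
  ⊑𝟏 x = ≡.sym (≡.trans (∧-comm x 𝟏) (∧-identityˡ x))

  𝟎°≡𝟏 : 𝟎 ° ≡ 𝟏
  𝟎°≡𝟏 = ≡.trans (cong _° (≡.sym 𝟏°)) (antisym (⊑𝟏 _) (x⊑x°° 𝟏))

  °°∈L°° : ∀ x → L°° (x °°)
  °°∈L°° x = ≡.sym (cong _° (°°°≡° x))

  L°°-∨ : ∀ {x y} → L°° x → L°° y → L°° (x ∨ y)
  L°°-∨ {x} {y} p q = ≡.trans (cong₂ _∨_ p q) (≡.sym (°°-∨ x y))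

  L°°-∧ : ∀ {x y} → L°° x → L°° y → L°° (x ∧ y)
  L°°-∧ {x} {y} p q = ≡.trans (cong₂ _∧_ p q) (≡.sym (°°-∧ x y))

  L°°-° : ∀ {x} → L°° x → L°° (x °)
  L°°-° {x} _ = ≡.sym (°°°≡° x)

  -- Complemented elements are closed: x ∨ x° = 1 forces x° ∧ x°° = 0, and
  -- then x°° = x°° ∧ (x ∨ x°) = x.
  B⇒L°° : ∀ {x} → B x → L°° x
  B⇒L°° {x} x∨x°≡𝟏 = ≡.sym (begin
    x °° ≡⟨ ⊑𝟏 (x °°) ⟩
    x °° ∧ 𝟏 ≡⟨ cong (x °° ∧_) (≡.sym x∨x°≡𝟏) ⟩
    x °° ∧ (x ∨ x °) ≡⟨ ∧-distribˡ-∨ _ _ _ ⟩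
    x °° ∧ x ∨ x °° ∧ x ° ≡⟨ cong₂ _∨_ (≡.trans (∧-comm _ _) (≤°° x)) x°°∧x°≡𝟎 ⟩
    x ∨ 𝟎 ≡⟨ ≡.trans (∨-comm x 𝟎) (∨-identityˡ x) ⟩
    x ∎)
    where
    open ≡.≡-Reasoning
    x°°∧x°≡𝟎 : x °° ∧ x ° ≡ 𝟎
    x°°∧x°≡𝟎 = ≡.trans (∧-comm _ _)
      (≡.trans (≡.sym (∨-° x (x °))) (≡.trans (cong _° x∨x°≡𝟏) 𝟏°))

  B⇔L-S×L°° : ∀ x → B x ⇔ (L-S x × L°° x)
  B⇔L-S×L°° x = mk⇔
    (λ b → let m = B⇒L°° b in
      ≡.trans (cong (x ° ∨_) (≡.sym m)) (≡.trans (∨-comm _ _) b) , m)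
    (λ { (s , m) → ≡.trans (∨-comm _ _) (≡.trans (cong (x ° ∨_) m) s) })

  B⇒L-S : ∀ {x} → B x → L-S x
  B⇒L-S b = proj₁ (to (B⇔L-S×L°° _) b)

  L-S⇔B°° : ∀ x → L-S x ⇔ B (x °°)
  L-S⇔B°° x = mk⇔
    (λ s → ≡.trans (cong (x °° ∨_) (°°°≡° x)) (≡.trans (∨-comm _ _) s))
    (λ b → ≡.trans (∨-comm _ _) (≡.trans (cong (x °° ∨_) (≡.sym (°°°≡° x))) b))

  whole⇔L°°°° : ∀ x → whole x ⇔ L°° (x °°)
  whole⇔L°°°° x = mk⇔ (λ _ → °°∈L°° x) (λ _ → tt)

  L°°⇔whole×L°° : ∀ x → L°° x ⇔ (whole x × L°° x)
  L°°⇔whole×L°° x = mk⇔ (tt ,_) proj₂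

  dense⇒L-S : ∀ {x} → D x → L-S x
  dense⇒L-S x°≡𝟎 = ≡.trans (cong (λ z → z ∨ z °) x°≡𝟎) (≡.trans (∨-identityˡ _) 𝟎°≡𝟏)

  rel-≡ : ∀ {P : Carrier → Set} {x x′ y y′} (θ : Congruence P) → x ≡ x′ → y ≡ y′ →
          rel θ x y ⇔ rel θ x′ y′
  rel-≡ θ ≡.refl ≡.refl = ⇔.refl

  pullback : ∀ {P Q : Carrier → Set} → (∀ x → P x ⇔ Q (x °°)) → Congruence Q → Congruence P
  pullback P⇔Q φ = record
    { rel = λ x y → rel φ (x °°) (y °°)
    ; support = λ r → from (P⇔Q _) (proj₁ (support φ r)) , from (P⇔Q _) (proj₂ (support φ r))
    ; refl = λ p → refl φ (to (P⇔Q _) p)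
    ; sym = sym φ
    ; trans = trans φ
    ; ∨-cong = λ {x} {y} {u} {v} r s →
        subst₂ (rel φ) (≡.sym (°°-∨ x u)) (≡.sym (°°-∨ y v)) (∨-cong φ r s)
    ; ∧-cong = λ {x} {y} {u} {v} r s →
        subst₂ (rel φ) (≡.sym (°°-∧ x u)) (≡.sym (°°-∧ y v)) (∧-cong φ r s)
    ; °-cong = °-cong φ
    }

  restrict : ∀ {P R : Carrier → Set} → (∀ x → R x ⇔ (P x × L°° x)) → Congruence P → Congruence R
  restrict R⇔P×L°° θ = record
    { rel = λ x y → L°° x × L°° y × rel θ x y
    ; support = λ { (mx , my , r) →
        from (R⇔P×L°° _) (proj₁ (support θ r) , mx) , from (R⇔P×L°° _) (proj₂ (support θ r) , my) }
    ; refl = λ rx → let (px , mx) = to (R⇔P×L°° _) rx in mx , mx , refl θ px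
    ; sym = λ { (mx , my , r) → my , mx , sym θ r }
    ; trans = λ { (mx , _ , r) (_ , mz , s) → mx , mz , trans θ r s }
    ; ∨-cong = λ { (mx , my , r) (mu , mv , s) → L°°-∨ mx mu , L°°-∨ my mv , ∨-cong θ r s }
    ; ∧-cong = λ { (mx , my , r) (mu , mv , s) → L°°-∧ mx mu , L°°-∧ my mv , ∧-cong θ r s }
    ; °-cong = λ { (mx , my , r) → L°°-° mx , L°°-° my , °-cong θ r }
    }

  restrict-rel : ∀ {P R : Carrier → Set} (R⇔P×L°° : ∀ x → R x ⇔ (P x × L°° x)) (θ : Congruence P) →
                 ∀ {x y} → L°° x → L°° y → rel (restrict R⇔P×L°° θ) x y ⇔ rel θ x y
  restrict-rel _ _ mx my = mk⇔ (λ r → proj₂ (proj₂ r)) (λ r → mx , my , r)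

  _∩_ : ∀ {P : Carrier → Set} → Congruence P → Congruence P → Congruence P
  θ ∩ ψ = record
    { rel = λ x y → rel θ x y × rel ψ x y
    ; support = λ r → support θ (proj₁ r)
    ; refl = λ p → refl θ p , refl ψ p
    ; sym = λ { (r , s) → sym θ r , sym ψ s }
    ; trans = λ { (r , s) (r′ , s′) → trans θ r r′ , trans ψ s s′ }
    ; ∨-cong = λ { (r , s) (r′ , s′) → ∨-cong θ r r′ , ∨-cong ψ s s′ }
    ; ∧-cong = λ { (r , s) (r′ , s′) → ∧-cong θ r r′ , ∧-cong ψ s s′ }
    ; °-cong = λ { (r , s) → °-cong θ r , °-cong ψ s }
    }

  rel⇔rel°° : (θ : Congruence L°°) → ∀ x y →
              rel θ x y ⇔ (L°° x × L°° y × rel θ (x °°) (y °°))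
  rel⇔rel°° θ x y = mk⇔
    (λ r → let (mx , my) = support θ r in mx , my , subst₂ (rel θ) mx my r)
    (λ { (mx , my , r) → subst₂ (rel θ) (≡.sym mx) (≡.sym my) r })

  lift : Congruence L°° → Congruence whole
  lift = pullback whole⇔L°°°°

  lift-S : Congruence B → Congruence L-S
  lift-S = pullback L-S⇔B°°

  lower : Congruence whole → Congruence L°°
  lower = restrict L°°⇔whole×L°°

  lower-S : Congruence L-S → Congruence B
  lower-S = restrict B⇔L-S×L°°

  ExtensionsAgree : (A : Carrier → Set) → ∀ {Q : Carrier → Set} → Congruence Q → Set₁
  ExtensionsAgree A φ = (θ₁ θ₂ : Congruence A) → Extends θ₁ φ → Extends θ₂ φ →
                        ∀ x y → rel θ₁ x y ⇔ rel θ₂ x y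

  lift-extends : ∀ {θ : Congruence L°°} {φ : Congruence B} →
                 Extends θ φ → Extends (lift θ) (lift-S φ)
  lift-extends ext x y sx sy = ext (x °°) (y °°) (to (L-S⇔B°° x) sx) (to (L-S⇔B°° y) sy)

  lower-extends : ∀ {θ : Congruence whole} {φ : Congruence L-S} →
                  Extends θ φ → Extends (lower θ) (lower-S φ)
  lower-extends ext x y bx by = ⇔.refl ×-⇔ ⇔.refl ×-⇔ ext x y (B⇒L-S bx) (B⇒L-S by)

  -- When extensions of φ are unique, an extension of φ lies below every
  -- congruence containing φ: it coincides with its meet with such a congruence.
  extension-least : ∀ {A Q : Carrier → Set} {φ : Congruence Q} → ExtensionsAgree A φ →
                    (θ ψ : Congruence A) → Extends θ φ →
                    (∀ {x y} → Q x → Q y → rel φ x y → rel ψ x y) →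
                    ∀ {x y} → rel θ x y → rel ψ x y
  extension-least {φ = φ} agree θ ψ θ-ext φ⊆ψ {x} {y} r =
    proj₂ (to (agree θ (θ ∩ ψ) θ-ext θ∩ψ-ext x y) r)
    where
    θ∩ψ-ext : Extends (θ ∩ ψ) φ
    θ∩ψ-ext a b qa qb = mk⇔ (λ r → to (θ-ext a b qa qb) (proj₁ r))
                            (λ r → from (θ-ext a b qa qb) r , φ⊆ψ qa qb r)

  -- (⇒): extend lift-S φ to L and lower the result; uniqueness because the
  -- lifts of two extensions both extend lift-S φ.
  perfect-S⇒perfect-B : PerfectExtension whole L-S → PerfectExtension L°° B
  perfect-S⇒perfect-B perfect φ = (lower θ , lower-θ-extends) , agree
    where
    θ : Congruence whole
    θ = proj₁ (proj₁ (perfect (lift-S φ)))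

    lower-θ-extends : Extends (lower θ) φ
    lower-θ-extends a b ba bb = begin
      rel (lower θ) a b    ∼⟨ restrict-rel L°°⇔whole×L°° θ (B⇒L°° ba) (B⇒L°° bb) ⟩
      rel θ a b            ∼⟨ proj₂ (proj₁ (perfect (lift-S φ))) a b (B⇒L-S ba) (B⇒L-S bb) ⟩
      rel φ (a °°) (b °°)  ∼⟨ rel-≡ φ (≡.sym (B⇒L°° ba)) (≡.sym (B⇒L°° bb)) ⟩
      rel φ a b            ∎
      where open ⇔-Reasoning

    agree : ExtensionsAgree L°° φ
    agree θ₁ θ₂ e₁ e₂ x y = begin
      rel θ₁ x y                               ∼⟨ rel⇔rel°° θ₁ x y ⟩
      (L°° x × L°° y × rel θ₁ (x °°) (y °°))  ∼⟨ ⇔.refl ×-⇔ ⇔.refl ×-⇔ lifts-agree ⟩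
      (L°° x × L°° y × rel θ₂ (x °°) (y °°))  ∼⟨ ⇔.sym (rel⇔rel°° θ₂ x y) ⟩
      rel θ₂ x y                               ∎
      where
      open ⇔-Reasoning
      lifts-agree : rel θ₁ (x °°) (y °°) ⇔ rel θ₂ (x °°) (y °°)
      lifts-agree = proj₂ (perfect (lift-S φ)) (lift θ₁) (lift θ₂)
                      (lift-extends {θ₁} {φ} e₁) (lift-extends {θ₂} {φ} e₂) x y

  -- Throughout, L is principal and d generates its filter D of dense elements.
  module Principal (d : Carrier) (principal : IsPrincipalWith d) where

    d°≡𝟎 : d ° ≡ 𝟎
    d°≡𝟎 = from (proj₁ principal d) (∧-idem d)

    d∈L-S : L-S d
    d∈L-S = dense⇒L-S d°≡𝟎

    -- Every x ∨ d is dense, hence lies in L-S.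
    ∨d∈L-S : ∀ x → L-S (x ∨ d)
    ∨d∈L-S x = dense⇒L-S (≡.trans (∨-° x d)
      (≡.trans (cong (x ° ∧_) d°≡𝟎) (≡.trans (∧-comm _ _) (≡.sym (𝟎⊑ _)))))

    ∨d-∨ : ∀ x u → (x ∨ d) ∨ (u ∨ d) ≡ (x ∨ u) ∨ d
    ∨d-∨ x u = begin
      (x ∨ d) ∨ (u ∨ d) ≡⟨ ∨-assoc x d (u ∨ d) ⟩
      x ∨ (d ∨ (u ∨ d)) ≡⟨ cong (x ∨_) (≡.sym (∨-assoc d u d)) ⟩
      x ∨ ((d ∨ u) ∨ d) ≡⟨ cong (λ z → x ∨ (z ∨ d)) (∨-comm d u) ⟩
      x ∨ ((u ∨ d) ∨ d) ≡⟨ cong (x ∨_) (∨-assoc u d d) ⟩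
      x ∨ (u ∨ (d ∨ d)) ≡⟨ cong (λ z → x ∨ (u ∨ z)) (∨-idem d) ⟩
      x ∨ (u ∨ d)       ≡⟨ ≡.sym (∨-assoc x u d) ⟩
      (x ∨ u) ∨ d       ∎
      where open ≡.≡-Reasoning

    ∨d-∧ : ∀ x u → (x ∨ d) ∧ (u ∨ d) ≡ (x ∧ u) ∨ d
    ∨d-∧ x u = ≡.sym (∨-distribʳ-∧ d x u)

    -- x is recovered from x°° and x ∨ d, so a congruence relates x and y
    -- iff it relates their two components.
    separate : ∀ {P : Carrier → Set} (θ : Congruence P) → P d → ∀ x y →
               rel θ x y ⇔ (rel θ (x °°) (y °°) × rel θ (x ∨ d) (y ∨ d))
    separate θ pd x y = mk⇔
      (λ r → °-cong θ (°-cong θ r) , ∨-cong θ r (refl θ pd))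
      (λ { (r , s) → subst₂ (rel θ) (≡.sym (proj₂ principal x)) (≡.sym (proj₂ principal y))
                       (∧-cong θ r s) })

    trace : Congruence L-S → Congruence L°°
    trace φ = record
      { rel = λ a b → L°° a × L°° b × rel φ (a ∨ d) (b ∨ d) × rel φ (a ° ∨ d) (b ° ∨ d)
      ; support = λ { (ma , mb , _) → ma , mb }
      ; refl = λ {a} ma → ma , ma , refl φ (∨d∈L-S a) , refl φ (∨d∈L-S (a °))
      ; sym = λ { (ma , mb , r , s) → mb , ma , sym φ r , sym φ s }
      ; trans = λ { (ma , _ , r , s) (_ , mc , r′ , s′) → ma , mc , trans φ r r′ , trans φ s s′ }
      ; ∨-cong = λ { {a} {b} {c} {e} (ma , mb , r , s) (mc , me , r′ , s′) →
          L°°-∨ ma mc , L°°-∨ mb me ,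
          subst₂ (rel φ) (∨d-∨ a c) (∨d-∨ b e) (∨-cong φ r r′) ,
          subst₂ (rel φ) (°∨d-∨ a c) (°∨d-∨ b e) (∧-cong φ s s′) }
      ; ∧-cong = λ { {a} {b} {c} {e} (ma , mb , r , s) (mc , me , r′ , s′) →
          L°°-∧ ma mc , L°°-∧ mb me ,
          subst₂ (rel φ) (∨d-∧ a c) (∨d-∧ b e) (∧-cong φ r r′) ,
          subst₂ (rel φ) (°∨d-∧ a c) (°∨d-∧ b e) (∨-cong φ s s′) }
      ; °-cong = λ { (ma , mb , r , s) →
          L°°-° ma , L°°-° mb , s ,
          subst₂ (λ p q → rel φ (p ∨ d) (q ∨ d)) ma mb r }
      }
      where
      °∨d-∨ : ∀ a c → (a ° ∨ d) ∧ (c ° ∨ d) ≡ (a ∨ c) ° ∨ d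
      °∨d-∨ a c = ≡.trans (∨d-∧ (a °) (c °)) (cong (_∨ d) (≡.sym (∨-° a c)))
      °∨d-∧ : ∀ a c → (a ° ∨ d) ∨ (c ° ∨ d) ≡ (a ∧ c) ° ∨ d
      °∨d-∧ a c = ≡.trans (∨d-∨ (a °) (c °)) (cong (_∨ d) (≡.sym (∧-° a c)))

    glue : (θ₁ : Congruence L°°) (φ : Congruence L-S) →
           (∀ {a b} → rel θ₁ a b → rel (trace φ) a b) → Congruence whole
    glue θ₁ φ θ₁⊆trace = record
      { rel = λ x y → rel (lift θ₁) x y × rel φ (x ∨ d) (y ∨ d)
      ; support = λ _ → tt , tt
      ; refl = λ {x} _ → refl (lift θ₁) tt , refl φ (∨d∈L-S x)
      ; sym = λ { (r , s) → sym (lift θ₁) r , sym φ s }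
      ; trans = λ { (r , s) (r′ , s′) → trans (lift θ₁) r r′ , trans φ s s′ }
      ; ∨-cong = λ { {x} {y} {u} {v} (r , s) (r′ , s′) →
          ∨-cong (lift θ₁) r r′ , subst₂ (rel φ) (∨d-∨ x u) (∨d-∨ y v) (∨-cong φ s s′) }
      ; ∧-cong = λ { {x} {y} {u} {v} (r , s) (r′ , s′) →
          ∧-cong (lift θ₁) r r′ , subst₂ (rel φ) (∨d-∧ x u) (∨d-∧ y v) (∧-cong φ s s′) }
      ; °-cong = λ { {x} {y} (r , _) →
          °-cong (lift θ₁) r ,
          subst₂ (λ p q → rel φ (p ∨ d) (q ∨ d)) (°°°≡° x) (°°°≡° y)
            (proj₂ (proj₂ (proj₂ (θ₁⊆trace r)))) }
      }

    -- (⇐): lower φ to B, extend to θ₁ on L°°, and glue θ₁ with φ; uniqueness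
    -- because a congruence of L is determined by its values on the elements
    -- x°° (seen by its lowering) and x ∨ d (seen by its restriction to L-S).
    perfect-B⇒perfect-S : PerfectExtension L°° B → PerfectExtension whole L-S
    perfect-B⇒perfect-S perfect φ = (glue θ₁ φ θ₁⊆trace , glue-extends) , agree
      where
      θ₁ : Congruence L°°
      θ₁ = proj₁ (proj₁ (perfect (lower-S φ)))

      θ₁-extends : Extends θ₁ (lower-S φ)
      θ₁-extends = proj₂ (proj₁ (perfect (lower-S φ)))

      θ₁⊆trace : ∀ {a b} → rel θ₁ a b → rel (trace φ) a b
      θ₁⊆trace = extension-least {φ = lower-S φ} (proj₂ (perfect (lower-S φ)))
                   θ₁ (trace φ) θ₁-extends λ { _ _ (ma , mb , r) →
          ma , mb , ∨-cong φ r (refl φ d∈L-S) , ∨-cong φ (°-cong φ r) (refl φ d∈L-S) }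

      glue-extends : Extends (glue θ₁ φ θ₁⊆trace) φ
      glue-extends x y sx sy = begin
        (rel θ₁ (x °°) (y °°) × rel φ (x ∨ d) (y ∨ d))
          ∼⟨ θ₁-extends (x °°) (y °°) (to (L-S⇔B°° x) sx) (to (L-S⇔B°° y) sy) ×-⇔ ⇔.refl ⟩
        (rel (lower-S φ) (x °°) (y °°) × rel φ (x ∨ d) (y ∨ d))
          ∼⟨ restrict-rel B⇔L-S×L°° φ (°°∈L°° x) (°°∈L°° y) ×-⇔ ⇔.refl ⟩
        (rel φ (x °°) (y °°) × rel φ (x ∨ d) (y ∨ d))
          ∼⟨ ⇔.sym (separate φ d∈L-S x y) ⟩
        rel φ x y ∎
        where open ⇔-Reasoning

      agree : ExtensionsAgree whole φ
      agree θa θb ea eb x y = begin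
        rel θa x y                                       ∼⟨ separate θa tt x y ⟩
        (rel θa (x °°) (y °°) × rel θa (x ∨ d) (y ∨ d))  ∼⟨ closed-parts-agree ×-⇔ dense-parts-agree ⟩
        (rel θb (x °°) (y °°) × rel θb (x ∨ d) (y ∨ d))  ∼⟨ ⇔.sym (separate θb tt x y) ⟩
        rel θb x y                                       ∎
        where
        open ⇔-Reasoning
        lowerings-agree : ∀ a b → rel (lower θa) a b ⇔ rel (lower θb) a b
        lowerings-agree = proj₂ (perfect (lower-S φ)) (lower θa) (lower θb)
                            (lower-extends {θa} {φ} ea) (lower-extends {θb} {φ} eb)

        closed-parts-agree : rel θa (x °°) (y °°) ⇔ rel θb (x °°) (y °°)
        closed-parts-agree = begin
          rel θa (x °°) (y °°)          ∼⟨ ⇔.sym (restrict-rel L°°⇔whole×L°° θa (°°∈L°° x) (°°∈L°° y)) ⟩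
          rel (lower θa) (x °°) (y °°)  ∼⟨ lowerings-agree (x °°) (y °°) ⟩
          rel (lower θb) (x °°) (y °°)  ∼⟨ restrict-rel L°°⇔whole×L°° θb (°°∈L°° x) (°°∈L°° y) ⟩
          rel θb (x °°) (y °°)          ∎

        dense-parts-agree : rel θa (x ∨ d) (y ∨ d) ⇔ rel θb (x ∨ d) (y ∨ d)
        dense-parts-agree = ⇔.trans (ea (x ∨ d) (y ∨ d) (∨d∈L-S x) (∨d∈L-S y))
                                    (⇔.sym (eb (x ∨ d) (y ∨ d) (∨d∈L-S x) (∨d∈L-S y)))

corollary4p5 : (L : MSAlgebra) → MSAlgebra.IsPrincipal L →
    (MSAlgebra.PerfectExtension L (MSAlgebra.whole L) (MSAlgebra.L-S L)
      ⇔ MSAlgebra.PerfectExtension L (MSAlgebra.L°° L) (MSAlgebra.B L))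
corollary4p5 L (d , principal) =
  mk⇔ perfect-S⇒perfect-B (Principal.perfect-B⇒perfect-S d principal)
  where open Theory L
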